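{- Let $n\geq 2$ and arrange $[n]=\{1,\ldots,n\}$ in the cyclic order $1,2,\ldots,n$ (elements taken mod $n$). Let $\hat{\mathcal{F}}$ be a family of intervals with respect to this cyclic order such that $\emptyset,[n]\notin\hat{\mathcal{F}}$ and every member of $\hat{\mathcal{F}}$ is contained in at most one other member of $\hat{\mathcal{F}}$. Let $m$ be the number of maximal members (with respect to inclusion) of $\hat{\mathcal{F}}$ and $a$ the number of non-maximal members. Then $$m+\frac{a}{2}\leq n.$$
   Context: An interval (with respect to the cyclic order $1,\ldots,n$ of $[n]$, elements taken mod $n$) is a subset of the form $\{k,k+1,\ldots,l\}$ with $1\leq k,l\leq n$. -}

module Defs where

open import Data.Nat using (ℕ; _+_; _∸_; _≤_; NonZero)
open import Data.Nat.DivMod using (_%_)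
open import Data.Fin using (Fin; toℕ)
open import Data.Fin.Subset using (Subset; _∈_; _⊂_)
open import Data.Fin.Subset.Properties using (_⊂?_)
open import Data.List using (List; length; filter)
open import Data.Product using (∃₂)
open import Function.Bundles using (_⇔_)
open import Relation.Nullary using (¬?)
open import Data.List.Relation.Unary.Any using (any?)

-- cyclic distance from k forward to x in the cyclic order 0,1,…,n-1 of Fin n
-- (Fin n ≅ [n] via i ↦ i+1): the number of steps k → k+1 → … → x (mod n)
offset : ∀ {n} → .{{NonZero n}} → Fin n → Fin n → ℕ
offset {n} k x = (toℕ x + n ∸ toℕ k) % n

inInterval : ∀ {n} → .{{NonZero n}} → Fin n → Fin n → Fin n → Set
inInterval k l x = offset k x ≤ offset k l

IsInterval : ∀ {n} → .{{NonZero n}} → Subset n → Set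
IsInterval S = ∃₂ λ k l → ∀ x → (x ∈ S) ⇔ inInterval k l x

strictSupersets : ∀ {n} → List (Subset n) → Subset n → List (Subset n)
strictSupersets fam F = filter (F ⊂?_) fam

maximals : ∀ {n} → List (Subset n) → List (Subset n)
maximals fam = filter (λ F → ¬? (any? (F ⊂?_) fam)) fam

nonMaximals : ∀ {n} → List (Subset n) → List (Subset n)
nonMaximals fam = filter (λ F → any? (F ⊂?_) fam) fam

-- Charge the members of the family to endpoint slots, a possible start and a possible
-- end for each of the n points. A member owns its start if no strict superset in the
-- family shares that start, and owns its end if every strict superset does. A maximal
-- member owns both slots; a non-maximal member has a unique strict superset, so it owns
-- one. No slot has two owners: members with a common start or a common end are nested,
-- the smaller one cannot own a start shared with the larger, and if it owned a common end
-- it would also share the start of the larger and hence coincide with it.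
module Submission where

open import Defs
open import Level using (Level)
open import Data.Nat using (ℕ; suc; _+_; _*_; _∸_; _≤_; _<_; _≥_; NonZero; z≤n; s≤s)
open import Data.Nat.Properties
open import Data.Nat.DivMod using (_%_; _/_; m%n<n; m≡m%n+[m/n]*n; m<n*o⇒m/o<n; %-distribˡ-+; [m+n]%n≡m%n)
open import Data.Nat.Tactic.RingSolver using (solve-∀)
open import Data.Fin using (Fin; toℕ)
open import Data.Fin.Properties using (toℕ≤n) renaming (_≟_ to _≟ᶠ_)
open import Data.Fin.Subset using (Subset; ⊥; ⊤; _⊆_; _⊂_) renaming (_∈_ to _∈ₛ_)
open import Data.Fin.Subset.Properties using (_⊂?_; ⊆-antisym) renaming (_∈?_ to _∈ₛ?_)
open import Data.List using (List; []; _∷_; length; map; filter; concatMap; _++_; allFin)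
open import Data.List.Properties using (length-++; length-map; length-tabulate; length-removeAt′; filter-all)
open import Data.List.Membership.Propositional using (_∈_; _─_; lose; find)
open import Data.List.Membership.Propositional.Properties
  using (∈-map⁺; ∈-filter⁺; ∈-filter⁻; ∈-length; ∈-concatMap⁻; ∈-allFin; ∈-++⁺ˡ; ∈-++⁺ʳ)
open import Data.List.Relation.Binary.Subset.Propositional using () renaming (_⊆_ to _⊆ˡ_)
open import Data.List.Relation.Unary.All as All using (All; []; _∷_)
open import Data.List.Relation.Unary.Any using (Any; here; there; index; any?)
open import Data.List.Relation.Unary.AllPairs using ([]; _∷_)
open import Data.List.Relation.Unary.Unique.Propositional using (Unique)
open import Data.List.Relation.Unary.Unique.Propositional.Properties using (++⁺; filter⁺; map⁻)
open import Data.Product using (Σ; ∃; _,_; _×_; proj₁; proj₂)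
open import Data.Sum using (_⊎_; inj₁; inj₂)
open import Data.Sum.Properties using (inj₁-injective; inj₂-injective)
open import Function using (_∘_; id)
open import Function.Bundles using (_⇔_; mk⇔; Equivalence)
open import Relation.Nullary using (¬_; yes; no; ¬?; _→-dec_; contradiction)
open import Relation.Unary using (Pred; Decidable)
open import Relation.Binary.PropositionalEquality
open Equivalence using (to; from)

private
  variable
    a b c p : Level
    A : Set a
    B : Set b
    C : Set c
    x y : A
    xs ys : List A

∈-─⁺ : (x∈ys : x ∈ ys) → y ∈ ys → y ≢ x → y ∈ ys ─ x∈ys
∈-─⁺ (here refl) (here refl) y≢x = contradiction refl y≢x
∈-─⁺ (here refl) (there y∈ys) _ = y∈ys
∈-─⁺ (there _) (here refl) _ = here refl
∈-─⁺ (there x∈ys) (there y∈ys) y≢x = there (∈-─⁺ x∈ys y∈ys y≢x)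

Unique-⊆⇒length≤ : Unique xs → xs ⊆ˡ ys → length xs ≤ length ys
Unique-⊆⇒length≤ {xs = []} _ _ = z≤n
Unique-⊆⇒length≤ {xs = x ∷ xs} {ys = ys} (x∉xs ∷ u) xs⊆ys = begin
  suc (length xs)          ≤⟨ s≤s (Unique-⊆⇒length≤ u xs⊆ys─x) ⟩
  suc (length (ys ─ x∈ys)) ≡⟨ sym (length-removeAt′ ys (index x∈ys)) ⟩
  length ys                ∎
  where
  open ≤-Reasoning
  x∈ys = xs⊆ys (here refl)
  xs⊆ys─x : xs ⊆ˡ ys ─ x∈ys
  xs⊆ys─x z∈xs = ∈-─⁺ x∈ys (xs⊆ys (there z∈xs)) (λ z≡x → All.lookup x∉xs z∈xs (sym z≡x))

length≤1⇒∈-unique : length xs ≤ 1 → x ∈ xs → y ∈ xs → x ≡ y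
length≤1⇒∈-unique {xs = _ ∷ []} _ (here refl) (here refl) = refl
length≤1⇒∈-unique {xs = _ ∷ _ ∷ _} (s≤s ())

Unique-map⇒injective-∈ : (f : A → B) → Unique (map f xs) → x ∈ xs → y ∈ xs → f x ≡ f y → x ≡ y
Unique-map⇒injective-∈ f _ (here refl) (here refl) _ = refl
Unique-map⇒injective-∈ f (fx∉ ∷ _) (here refl) (there y∈xs) e =
  contradiction e (All.lookup fx∉ (∈-map⁺ f y∈xs))
Unique-map⇒injective-∈ f (fy∉ ∷ _) (there x∈xs) (here refl) e =
  contradiction (sym e) (All.lookup fy∉ (∈-map⁺ f x∈xs))
Unique-map⇒injective-∈ f (_ ∷ u) (there x∈xs) (there y∈xs) e = Unique-map⇒injective-∈ f u x∈xs y∈xs e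

Unique-concatMap⁺ : (f : A → List B) → Unique xs → (∀ x → Unique (f x)) →
  (∀ {x y b} → x ∈ xs → y ∈ xs → b ∈ f x → b ∈ f y → x ≡ y) → Unique (concatMap f xs)
Unique-concatMap⁺ {xs = []} f _ _ _ = []
Unique-concatMap⁺ {xs = x ∷ xs} f (x∉xs ∷ u) uf disjoint =
  ++⁺ (uf x) (Unique-concatMap⁺ f u uf λ x∈ y∈ → disjoint (there x∈) (there y∈)) separated
  where
  separated : ∀ {b} → ¬ (b ∈ f x × b ∈ concatMap f xs)
  separated (b∈fx , b∈rest) with find (∈-concatMap⁻ f b∈rest)
  ... | y , y∈xs , b∈fy = All.lookup x∉xs y∈xs (disjoint (here refl) (there y∈xs) b∈fx b∈fy)

module _ {P : Pred B p} (P? : Decidable P) (g : A → B) (f : A → List C) where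

  filterCounts≤length-concatMap : ∀ xs →
    (∀ {x} → x ∈ xs → 1 ≤ length (f x)) →
    (∀ {x} → x ∈ xs → ¬ P (g x) → 2 ≤ length (f x)) →
    2 * length (filter (¬? ∘ P?) (map g xs)) + length (filter P? (map g xs)) ≤ length (concatMap f xs)
  filterCounts≤length-concatMap [] _ _ = z≤n
  filterCounts≤length-concatMap (x ∷ xs) one two
    rewrite length-++ (f x) {concatMap f xs}
    with P? (g x) | filterCounts≤length-concatMap xs (one ∘ there) (two ∘ there)
  ... | yes _  | ih = ≤-trans (≤-reflexive (+-suc _ _)) (+-mono-≤ (one (here refl)) ih)
  ... | no ¬p | ih = ≤-trans (≤-reflexive (trans (cong (_+ k) (*-suc 2 m)) (+-assoc 2 (2 * m) k)))
                              (+-mono-≤ (two (here refl) ¬p) ih)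
    where
    m = length (filter (¬? ∘ P?) (map g xs))
    k = length (filter P? (map g xs))

⊆⇒≡⊎⊂ : ∀ {n} {S S′ : Subset n} → S ⊆ S′ → S ≡ S′ ⊎ S ⊂ S′
⊆⇒≡⊎⊂ {S = S} {S′} S⊆S′ with S ⊂? S′
... | yes S⊂S′ = inj₂ S⊂S′
... | no S⊄S′ = inj₁ (⊆-antisym S⊆S′ S′⊆S)
  where
  S′⊆S : S′ ⊆ S
  S′⊆S {x} x∈S′ with x ∈ₛ? S
  ... | yes x∈S = x∈S
  ... | no x∉S = contradiction ((λ {y} → S⊆S′ {y}) , x , x∈S′ , x∉S) S⊄S′

module _ {n : ℕ} .{{_ : NonZero n}} where

  offset<n : (k x : Fin n) → offset k x < n
  offset<n k x = m%n<n _ n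

  m<2n⇒m≡m%n⊎m≡m%n+n : ∀ m → m < 2 * n → m ≡ m % n ⊎ m ≡ m % n + n
  m<2n⇒m≡m%n⊎m≡m%n+n m m<2n with m / n | m<n*o⇒m/o<n {m} {2} {n} m<2n | m≡m%n+[m/n]*n m n
  ... | 0           | _              | m≡ = inj₁ (trans m≡ (+-identityʳ _))
  ... | 1           | _              | m≡ = inj₂ (trans m≡ (cong (m % n +_) (+-identityʳ n)))
  ... | suc (suc _) | s≤s (s≤s ()) | _

  arcs-sum : ∀ {K X} L → K ≤ n → X ≤ n → (X + n ∸ K) + (L + n ∸ X) ≡ (L + n ∸ K) + n
  arcs-sum {K} {X} L K≤n X≤n = begin
    (X + n ∸ K) + (L + n ∸ X)     ≡⟨ cong₂ _+_ (+-∸-assoc X K≤n) (+-∸-assoc L X≤n) ⟩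
    (X + (n ∸ K)) + (L + (n ∸ X)) ≡⟨ exchange X (n ∸ K) L (n ∸ X) ⟩
    (L + (n ∸ K)) + (X + (n ∸ X)) ≡⟨ cong₂ _+_ (sym (+-∸-assoc L K≤n)) (m+[n∸m]≡n X≤n) ⟩
    (L + n ∸ K) + n               ∎
    where
    open ≡-Reasoning
    exchange : ∀ a b c d → (a + b) + (c + d) ≡ (c + b) + (a + d)
    exchange = solve-∀

  offset-triangle : (k x l : Fin n) →
    offset k x + offset x l ≡ offset k l ⊎ offset k x + offset x l ≡ offset k l + n
  offset-triangle k x l = subst (λ r → s ≡ r ⊎ s ≡ r + n) sum%n (m<2n⇒m≡m%n⊎m≡m%n+n s sum<2n)
    where
    open ≡-Reasoning
    K = toℕ k ; X = toℕ x ; L = toℕ l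
    s = offset k x + offset x l
    sum<2n : s < 2 * n
    sum<2n = subst (s <_) (cong (n +_) (sym (+-identityʳ n))) (+-mono-< (offset<n k x) (offset<n x l))
    sum%n : s % n ≡ offset k l
    sum%n = begin
      ((X + n ∸ K) % n + (L + n ∸ X) % n) % n ≡⟨ sym (%-distribˡ-+ (X + n ∸ K) (L + n ∸ X) n) ⟩
      ((X + n ∸ K) + (L + n ∸ X)) % n         ≡⟨ cong (_% n) (arcs-sum L (toℕ≤n k) (toℕ≤n x)) ⟩
      ((L + n ∸ K) + n) % n                   ≡⟨ [m+n]%n≡m%n (L + n ∸ K) n ⟩
      (L + n ∸ K) % n                         ∎

  offset-split : (k x l : Fin n) → offset k x ≤ offset k l ⊎ offset x l ≤ offset k l →
    offset k x + offset x l ≡ offset k l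
  offset-split k x l arc with offset-triangle k x l
  ... | inj₁ split = split
  ... | inj₂ wrap with arc
  ...   | inj₁ kx≤kl = contradiction (+-cancelˡ-≤ (offset k x) n (offset x l) (begin
            offset k x + n            ≤⟨ +-monoˡ-≤ n kx≤kl ⟩
            offset k l + n            ≡⟨ sym wrap ⟩
            offset k x + offset x l   ∎)) (<⇒≱ (offset<n x l))
    where open ≤-Reasoning
  ...   | inj₂ xl≤kl = contradiction (+-cancelʳ-≤ (offset x l) n (offset k x) (begin
            n + offset x l            ≤⟨ +-monoʳ-≤ n xl≤kl ⟩
            n + offset k l            ≡⟨ +-comm n (offset k l) ⟩
            offset k l + n            ≡⟨ sym wrap ⟩
            offset k x + offset x l   ∎)) (<⇒≱ (offset<n k x))
    where open ≤-Reasoning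

  inInterval⇔offset[x,l]≤offset[k,l] : (k l x : Fin n) → inInterval k l x ⇔ offset x l ≤ offset k l
  inInterval⇔offset[x,l]≤offset[k,l] k l x = mk⇔
    (λ kx≤kl → subst (offset x l ≤_) (offset-split k x l (inj₁ kx≤kl)) (m≤n+m _ _))
    (λ xl≤kl → subst (offset k x ≤_) (offset-split k x l (inj₂ xl≤kl)) (m≤m+n _ _))

  HasEndpoints : Subset n → Fin n → Fin n → Set
  HasEndpoints S k l = ∀ x → (x ∈ₛ S) ⇔ inInterval k l x

  sameStart-⊆ : ∀ {S S′ k l l′} → HasEndpoints S k l → HasEndpoints S′ k l′ →
    offset k l ≤ offset k l′ → S ⊆ S′
  sameStart-⊆ S≐ S′≐ kl≤kl′ {x} x∈S = from (S′≐ x) (≤-trans (to (S≐ x) x∈S) kl≤kl′)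

  sameEnd-⊆ : ∀ {S S′ k k′ l} → HasEndpoints S k l → HasEndpoints S′ k′ l →
    offset k l ≤ offset k′ l → S ⊆ S′
  sameEnd-⊆ {k = k} {k′} {l} S≐ S′≐ kl≤k′l {x} x∈S =
    from (S′≐ x) (from (inInterval⇔offset[x,l]≤offset[k,l] k′ l x)
      (≤-trans (to (inInterval⇔offset[x,l]≤offset[k,l] k l x) (to (S≐ x) x∈S)) kl≤k′l))

  -- The endpoints of ⊤ are not determined by the set, so an interval carries its chosen ones.
  Interval : Set
  Interval = ∃ IsInterval

  set : Interval → Subset n
  set = proj₁

  start end : Interval → Fin n
  start I = proj₁ (proj₂ I)
  end I = proj₁ (proj₂ (proj₂ I))

  sameStart⇒comparable : (I J : Interval) → start I ≡ start J → set I ⊆ set J ⊎ set J ⊆ set I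
  sameStart⇒comparable (_ , k , l , I≐) (_ , _ , l′ , J≐) refl with ≤-total (offset k l) (offset k l′)
  ... | inj₁ kl≤kl′ = inj₁ (sameStart-⊆ {k = k} I≐ J≐ kl≤kl′)
  ... | inj₂ kl′≤kl = inj₂ (sameStart-⊆ {k = k} J≐ I≐ kl′≤kl)

  sameEnd⇒comparable : (I J : Interval) → end I ≡ end J → set I ⊆ set J ⊎ set J ⊆ set I
  sameEnd⇒comparable (_ , k , l , I≐) (_ , k′ , _ , J≐) refl with ≤-total (offset k l) (offset k′ l)
  ... | inj₁ kl≤k′l = inj₁ (sameEnd-⊆ {k = k} {k′} I≐ J≐ kl≤k′l)
  ... | inj₂ k′l≤kl = inj₂ (sameEnd-⊆ {k = k′} {k} J≐ I≐ k′l≤kl)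

  sameEndpoints⇒≡ : (I J : Interval) → start I ≡ start J → end I ≡ end J → set I ≡ set J
  sameEndpoints⇒≡ (_ , k , l , I≐) (_ , _ , _ , J≐) refl refl =
    ⊆-antisym (sameStart-⊆ {k = k} {l} {l} I≐ J≐ ≤-refl)
              (sameStart-⊆ {k = k} {l} {l} J≐ I≐ ≤-refl)

  Slot : Set
  Slot = Fin n ⊎ Fin n

  endpoints : Interval → List Slot
  endpoints I = inj₁ (start I) ∷ inj₂ (end I) ∷ []

  allSlots : List Slot
  allSlots = map inj₁ (allFin n) ++ map inj₂ (allFin n)

  ∈-allSlots : ∀ s → s ∈ allSlots
  ∈-allSlots (inj₁ k) = ∈-++⁺ˡ (∈-map⁺ inj₁ (∈-allFin k))
  ∈-allSlots (inj₂ l) = ∈-++⁺ʳ (map inj₁ (allFin n)) (∈-map⁺ inj₂ (∈-allFin l))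

  length-allSlots : length allSlots ≡ 2 * n
  length-allSlots = begin
    length (map inj₁ (allFin n) ++ map inj₂ (allFin n))
      ≡⟨ length-++ (map inj₁ (allFin n)) ⟩
    length (map inj₁ (allFin n)) + length (map inj₂ (allFin n))
      ≡⟨ cong₂ _+_ (length-map inj₁ (allFin n)) (length-map inj₂ (allFin n)) ⟩
    length (allFin n) + length (allFin n)
      ≡⟨ cong₂ _+_ length-allFin length-allFin ⟩
    n + n
      ≡⟨ cong (n +_) (sym (+-identityʳ n)) ⟩
    2 * n ∎
    where
    open ≡-Reasoning
    length-allFin : length (allFin n) ≡ n
    length-allFin = length-tabulate id

  module _ (reps : List Interval) where

    OwnsStart OwnsEnd : Interval → Set
    OwnsStart I = All (λ J → set I ⊂ set J → start I ≢ start J) reps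
    OwnsEnd I = All (λ J → set I ⊂ set J → start I ≡ start J) reps

    Owns : Interval → Slot → Set
    Owns I (inj₁ _) = OwnsStart I
    Owns I (inj₂ _) = OwnsEnd I

    owns? : ∀ I → Decidable (Owns I)
    owns? I (inj₁ _) = All.all? (λ J → set I ⊂? set J →-dec ¬? (start I ≟ᶠ start J)) reps
    owns? I (inj₂ _) = All.all? (λ J → set I ⊂? set J →-dec start I ≟ᶠ start J) reps

    ownedSlots : Interval → List Slot
    ownedSlots I = filter (owns? I) (endpoints I)

    Unique-ownedSlots : ∀ I → Unique (ownedSlots I)
    Unique-ownedSlots I = filter⁺ (owns? I) {xs = endpoints I} (((λ ()) ∷ []) ∷ [] ∷ [])

    nestedOwners-start : ∀ {I J} → J ∈ reps → OwnsStart I → start I ≡ start J →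
      set I ⊆ set J → set I ≡ set J
    nestedOwners-start J∈ I-owns k≡ I⊆J with ⊆⇒≡⊎⊂ I⊆J
    ... | inj₁ I≡J = I≡J
    ... | inj₂ I⊂J = contradiction k≡ (All.lookup I-owns J∈ I⊂J)

    nestedOwners-end : ∀ {I J} → J ∈ reps → OwnsEnd I → end I ≡ end J →
      set I ⊆ set J → set I ≡ set J
    nestedOwners-end {I} {J} J∈ I-owns l≡ I⊆J with ⊆⇒≡⊎⊂ I⊆J
    ... | inj₁ I≡J = I≡J
    ... | inj₂ I⊂J = sameEndpoints⇒≡ I J (All.lookup I-owns J∈ I⊂J) l≡

    sameStart-owners : ∀ {I J} → I ∈ reps → J ∈ reps → OwnsStart I → OwnsStart J →
      start I ≡ start J → set I ≡ set J
    sameStart-owners {I} {J} I∈ J∈ I-owns J-owns k≡ with sameStart⇒comparable I J k≡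
    ... | inj₁ I⊆J = nestedOwners-start {I} J∈ I-owns k≡ I⊆J
    ... | inj₂ J⊆I = sym (nestedOwners-start {J} I∈ J-owns (sym k≡) J⊆I)

    sameEnd-owners : ∀ {I J} → I ∈ reps → J ∈ reps → OwnsEnd I → OwnsEnd J →
      end I ≡ end J → set I ≡ set J
    sameEnd-owners {I} {J} I∈ J∈ I-owns J-owns l≡ with sameEnd⇒comparable I J l≡
    ... | inj₁ I⊆J = nestedOwners-end {I} J∈ I-owns l≡ I⊆J
    ... | inj₂ J⊆I = sym (nestedOwners-end {J} I∈ J-owns (sym l≡) J⊆I)

    owner-unique : ∀ {I J s} → I ∈ reps → J ∈ reps →
      s ∈ ownedSlots I → s ∈ ownedSlots J → set I ≡ set J
    owner-unique {I} {J} I∈ J∈ s∈I s∈J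
      with ∈-filter⁻ (owns? I) {xs = endpoints I} s∈I | ∈-filter⁻ (owns? J) {xs = endpoints J} s∈J
    ... | here refl , I-owns         | here k≡ , J-owns         =
      sameStart-owners I∈ J∈ I-owns J-owns (inj₁-injective k≡)
    ... | there (here refl) , I-owns | there (here l≡) , J-owns =
      sameEnd-owners I∈ J∈ I-owns J-owns (inj₂-injective l≡)
    ... | here refl , _              | there (here ()) , _
    ... | there (here refl) , _      | here () , _

    module _ (u : Unique (map set reps))
             (sup : ∀ F → F ∈ map set reps → length (strictSupersets (map set reps) F) ≤ 1) where

      strictSuperset-unique : ∀ {I J J′} → I ∈ reps → J ∈ reps → J′ ∈ reps →
        set I ⊂ set J → set I ⊂ set J′ → J ≡ J′
      strictSuperset-unique {I} I∈ J∈ J′∈ I⊂J I⊂J′ = Unique-map⇒injective-∈ set u J∈ J′∈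
        (length≤1⇒∈-unique (sup (set I) (∈-map⁺ set I∈))
          (∈-filter⁺ (set I ⊂?_) (∈-map⁺ set J∈) I⊂J)
          (∈-filter⁺ (set I ⊂?_) (∈-map⁺ set J′∈) I⊂J′))

      ownsStart⊎ownsEnd : ∀ {I} → I ∈ reps → OwnsStart I ⊎ OwnsEnd I
      ownsStart⊎ownsEnd {I} I∈ with owns? I (inj₁ (start I))
      ... | yes I-owns = inj₁ I-owns
      ... | no ¬I-owns = inj₂ (All.tabulate sharesStart)
        where
        sharesStart : ∀ {J} → J ∈ reps → set I ⊂ set J → start I ≡ start J
        sharesStart {J} J∈ I⊂J with start I ≟ᶠ start J
        ... | yes k≡ = k≡
        ... | no k≢ = contradiction (All.tabulate differs) ¬I-owns
          where
          differs : ∀ {J′} → J′ ∈ reps → set I ⊂ set J′ → start I ≢ start J′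
          differs J′∈ I⊂J′ rewrite strictSuperset-unique I∈ J′∈ J∈ I⊂J′ I⊂J = k≢

      maximal⇒owns : ∀ I → ¬ Any (set I ⊂_) (map set reps) → All (Owns I) (endpoints I)
      maximal⇒owns I ¬sup = vacuous ∷ vacuous ∷ []
        where
        vacuous : ∀ {Q : Interval → Set} → All (λ J → set I ⊂ set J → Q J) reps
        vacuous = All.tabulate λ J∈ I⊂J → contradiction (lose (∈-map⁺ set J∈) I⊂J) ¬sup

      ownedSlots-nonempty : ∀ {I} → I ∈ reps → 1 ≤ length (ownedSlots I)
      ownedSlots-nonempty {I} I∈ with ownsStart⊎ownsEnd I∈
      ... | inj₁ I-owns = ∈-length (∈-filter⁺ (owns? I) {xs = endpoints I} (here refl) I-owns)
      ... | inj₂ I-owns = ∈-length (∈-filter⁺ (owns? I) {xs = endpoints I} (there (here refl)) I-owns)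

      maximal⇒length-ownedSlots : ∀ I → ¬ Any (set I ⊂_) (map set reps) → 2 ≤ length (ownedSlots I)
      maximal⇒length-ownedSlots I ¬sup =
        ≤-reflexive (cong length (sym (filter-all (owns? I) (maximal⇒owns I ¬sup))))

      maximals-bound : 2 * length (maximals (map set reps)) + length (nonMaximals (map set reps)) ≤ 2 * n
      maximals-bound = begin
        2 * length (maximals (map set reps)) + length (nonMaximals (map set reps))
          ≤⟨ filterCounts≤length-concatMap (λ F → any? (F ⊂?_) (map set reps)) set ownedSlots reps
               ownedSlots-nonempty (λ {I} _ → maximal⇒length-ownedSlots I) ⟩
        length (concatMap ownedSlots reps)
          ≤⟨ Unique-⊆⇒length≤ (Unique-concatMap⁺ ownedSlots (map⁻ u) Unique-ownedSlots disjoint)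
               (λ {s} _ → ∈-allSlots s) ⟩
        length allSlots
          ≡⟨ length-allSlots ⟩
        2 * n ∎
        where
        open ≤-Reasoning
        disjoint : ∀ {I J s} → I ∈ reps → J ∈ reps →
          s ∈ ownedSlots I → s ∈ ownedSlots J → I ≡ J
        disjoint I∈ J∈ s∈I s∈J = Unique-map⇒injective-∈ set u I∈ J∈ (owner-unique I∈ J∈ s∈I s∈J)

intervalsOf : ∀ {n} .{{_ : NonZero n}} {fam : List (Subset n)} → All IsInterval fam →
  Σ (List Interval) λ reps → map set reps ≡ fam
intervalsOf [] = [] , refl
intervalsOf (F≐ ∷ allI) with intervalsOf allI
... | reps , refl = (_ , F≐) ∷ reps , refl

lemma1 : (n : ℕ) → .{{_ : NonZero n}} → n ≥ 2 →
    (fam : List (Subset n)) → Unique fam →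
    All IsInterval fam →
    All (λ F → F ≢ ⊥) fam →
    All (λ F → F ≢ ⊤) fam →
    (∀ F → F ∈ fam → length (strictSupersets fam F) ≤ 1) →
    2 * length (maximals fam) + length (nonMaximals fam) ≤ 2 * n
lemma1 n _ fam u allI _ _ sup with intervalsOf allI
... | reps , refl = maximals-bound reps u sup
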